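{- Let $n\geq 1$, let $B,J$ be finite sets and $f:B^J\to\{0,1\}^{I_n}$ with $f(B^J)=\mathsf{Mon}_n$. For all $i,j\in I_n$ and $v\in\{0,1\}$, there exists a partial input $\alpha$ with $$\mathrm{dom}(\alpha)=\Uparrow[\![i+1,j]\!]\ \cup\ \Uparrow[\![j,i]\!]$$ such that $f(x)_j=v$ for every $x\in B^J$ extending $\alpha$.
   Context: For a function $f:B^J\to A^I$ with $B,J,A,I$ finite, the input window $\mathcal{W}_f(i)\subseteq J$ of $i\in I$ is the smallest $W\subseteq J$ such that for all $x,y\in B^J$ agreeing on $W$, $f(x)_i=f(y)_i$. For $S\subseteq I$, $\Uparrow S=\bigcap_{i\in S}\mathcal{W}_f(i)$. A partial input is a function $\alpha:D\to B$ for some $D\subseteq J$ (its domain $\mathrm{dom}(\alpha)$); $x\in B^J$ extends $\alpha$ if $x$ agrees with $\alpha$ on $D$. $\mathsf{Mon}_n\subseteq\{0,1\}^n$ is the set of binary strings $x_0\ldots x_{n-1}$ that are non-decreasing or non-increasing. Positions $I_n=\{0,\ldots,n-1\}$ are identified with $\mathbb{Z}/n\mathbb{Z}$. For $a,b\in\mathbb{Z}$, the interval $[\![a,b]\!]=\{c\bmod n: c\in\mathbb{Z},\ a\leq c\leq b'\}$ where $b'$ is the representative of $b$ modulo $n$ with $a\leq b'<a+n$ (it depends only on $a,b$ modulo $n$). -}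

module Defs where

open import Data.Nat as ℕ using (ℕ; suc; NonZero)
open import Data.Nat.DivMod using (_%_)
open import Data.Fin using (Fin; toℕ)
open import Data.Fin.Subset using (Subset; _∈_; _⊆_)
open import Data.Bool as Bool using (Bool)
open import Data.Maybe using (Maybe; just)
open import Data.Product using (_×_; ∃)
open import Data.Sum using (_⊎_)
open import Relation.Binary.PropositionalEquality using (_≡_)

-- Inputs B^J with B = Fin b, J = Fin m; outputs {0,1}^{I_n} = Fin n → Bool.
Input : ℕ → ℕ → Set
Input m b = Fin m → Fin b

Determines : ∀ {m b n} → (Input m b → (Fin n → Bool)) → Fin n → Subset m → Set
Determines f i W = ∀ x y → (∀ k → k ∈ W → x k ≡ y k) → f x i ≡ f y i

IsWindow : ∀ {m b n} → (Input m b → (Fin n → Bool)) → Fin n → Subset m → Set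
IsWindow f i W = Determines f i W × (∀ W′ → Determines f i W′ → W ⊆ W′)

-- Mon_n : non-decreasing or non-increasing binary strings (false = 0 ≤ true = 1).
NonDecr NonIncr Mon : ∀ {n} → (Fin n → Bool) → Set
NonDecr x = ∀ p q → p Data.Fin.≤ q → x p Bool.≤ x q
NonIncr x = ∀ p q → p Data.Fin.≤ q → x q Bool.≤ x p
Mon x = NonDecr x ⊎ NonIncr x

ImageIsMon : ∀ {m b n} → (Input m b → (Fin n → Bool)) → Set
ImageIsMon {n = n} f = (∀ x → Mon (f x)) × (∀ (y : Fin n → Bool) → Mon y → ∃ λ x → ∀ k → f x k ≡ y k)

-- offset of c from a in ℤ/nℤ, as a number in {0,…,n-1}
offset : (n : ℕ) → .{{NonZero n}} → ℕ → ℕ → ℕ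
offset n a c = ((n ℕ.+ c % n) ℕ.∸ a % n) % n

-- c ∈ ⟦a,b⟧ (cyclic interval in ℤ/nℤ, a,b given by integer representatives ≥ 0)
InInterval : (n : ℕ) → .{{NonZero n}} → ℕ → ℕ → Fin n → Set
InInterval n a b c = offset n a (toℕ c) ℕ.≤ offset n a b

-- k ∈ ⇑S where S = ⟦a,b⟧ and w i is the window of i: k lies in every w i with i ∈ S.
InUp : ∀ {m} (n : ℕ) → .{{NonZero n}} → (Fin n → Subset m) → ℕ → ℕ → Fin m → Set
InUp n w a b k = ∀ i → InInterval n a b i → k ∈ w i

-- Partial inputs α : D → B, represented as Fin m → Maybe (Fin b); dom α = {k | α k ≠ nothing}.
PartialInput : ℕ → ℕ → Set
PartialInput m b = Fin m → Maybe (Fin b)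

InDom : ∀ {m b} → PartialInput m b → Fin m → Set
InDom α k = ∃ λ c → α k ≡ just c

Extends : ∀ {m b} → Input m b → PartialInput m b → Set
Extends x α = ∀ k c → α k ≡ just c → x k ≡ c

-- Extend each output string t antiperiodically to ℕ (ext t (e + n) ≡ not (ext t e)). For a monotone
-- t the extension changes value at most once in any n consecutive positions, so the cyclic
-- intervals of the statement become ordinary intervals [lo, hi] of ℕ with hi < lo + n, and the
-- extension of f Z is constant on [lo, hi] as soon as it agrees at lo and hi.
--
-- Main lemma (forcing): if ext (f Z) agrees at lo and hi, then every x that agrees with Z on
-- ⇑[lo, J] ∪ ⇑[J, hi] has the same output as Z at J mod n. By induction on hi − lo: if x changed
-- that output, consider the hybrids that copy Z on W_lo ∪ W_hi, W_lo, W_hi, W_lo ∩ W_hi and x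
-- elsewhere (W_e being the window of e mod n). The induction hypotheses for [lo+1, hi] and
-- [lo, hi−1], together with window determination, force the last hybrid to have an extension
-- that is constant on [lo+1, hi] and opposite to that of Z at J, while the hypothesis for
-- [lo+1, hi] forces it to agree with Z at J.
--
-- The theorem takes for f Z the monotone string that switches between i and i+1 and has value v
-- at j, and [lo, hi] = [i+1, i+n].

module Submission where

open import Defs
open import Data.Bool as Bool using (Bool; true; false; not; if_then_else_; _∧_; _∨_; _xor_)
open import Data.Bool.Properties as Bool using (not-injective; ¬-not; not-¬)
open import Data.Empty using (⊥; ⊥-elim)
open import Data.Fin as Fin using (Fin; toℕ)
open import Data.Fin.Properties as Fin using (toℕ-fromℕ<; fromℕ<-cong; toℕ-injective; toℕ<n; all?)
open import Data.Fin.Subset using (Subset; _∈_)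
open import Data.Fin.Subset.Properties using (_∈?_)
open import Data.Maybe using (just; nothing)
open import Data.Nat as ℕ using (ℕ; zero; suc; NonZero; _+_; _*_; _∸_; _≤_; _<_; s≤s; z≤n)
open import Data.Nat.DivMod
open import Data.Nat.Properties as ℕ
  using ( ≤-refl; ≤-trans; <⇒≤; <-≤-trans; ≤-<-trans; m≤n⇒m<n∨m≡n; +-cancelʳ-≤; +-cancelʳ-<
        ; m≤m+n; m≤n+m; +-comm; +-assoc; m+n∸n≡m; m∸n+n≡m)
open import Data.Nat.Tactic.RingSolver using (solve-∀)
open import Data.Product using (_×_; _,_; proj₁; proj₂; ∃)
open import Data.Sum as Sum using (_⊎_; inj₁; inj₂)
open import Data.Vec using (lookup)
open import Data.Vec.Properties using ([]=⇒lookup; lookup⇒[]=)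
open import Function using (_∘_)
open import Function.Bundles using (_⇔_; mk⇔)
open import Relation.Binary.PropositionalEquality
open import Relation.Nullary using (contradiction; Dec; does; yes; no)
open import Relation.Nullary.Decidable using (dec-true; dec-false; _→-dec_; _⊎-dec_)

flipped : ℕ → Bool → Bool
flipped zero    β = β
flipped (suc k) β = not (flipped k β)

flipped-injective : ∀ k {β β′} → flipped k β ≡ flipped k β′ → β ≡ β′
flipped-injective zero    eq = eq
flipped-injective (suc k) eq = flipped-injective k (not-injective eq)

not-antitone : ∀ {β γ} → β Bool.≤ γ → not γ Bool.≤ not β
not-antitone Bool.b≤b = Bool.b≤b
not-antitone Bool.f≤t = Bool.f≤t

module _ {n : ℕ} .{{_ : NonZero n}} where

  toℕ-mod : ∀ e → toℕ (e mod n) ≡ e % n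
  toℕ-mod e = toℕ-fromℕ< (m%n<n e n)

  toℕ-mod-< : ∀ {e} → e < n → toℕ (e mod n) ≡ e
  toℕ-mod-< {e} e<n = trans (toℕ-mod e) (m<n⇒m%n≡m e<n)

  [e+n]/n≡1+e/n : ∀ e → (e + n) / n ≡ suc (e / n)
  [e+n]/n≡1+e/n e = trans (m/n≡1+[m∸n]/n (m≤n+m n e)) (cong (λ d → suc (d / n)) (m+n∸n≡m e n))

  mod-periodic : ∀ e → (e + n) mod n ≡ e mod n
  mod-periodic e = fromℕ<-cong _ _ ([m+n]%n≡m%n e n) _ _

  quotient-step : ∀ {e e′} → e ≤ e′ → e′ < e + n → e′ / n ≡ e / n ⊎ e′ / n ≡ suc (e / n)
  quotient-step {e} {e′} e≤e′ e′<e+n with m≤n⇒m<n∨m≡n (subst (e′ / n ≤_) ([e+n]/n≡1+e/n e) (/-monoˡ-≤ n (<⇒≤ e′<e+n)))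
  ... | inj₁ (s≤s k′≤k) = inj₁ (ℕ.≤-antisym k′≤k (/-monoˡ-≤ n e≤e′))
  ... | inj₂ k′≡1+k     = inj₂ k′≡1+k

  mod-mono : ∀ {e e′} → e ≤ e′ → e / n ≡ e′ / n → e mod n Fin.≤ e′ mod n
  mod-mono {e} {e′} e≤e′ same = subst₂ _≤_ (sym (toℕ-mod e)) (sym (toℕ-mod e′))
    (+-cancelʳ-≤ (e / n * n) (e % n) (e′ % n) (begin
      e % n + e / n * n    ≡⟨ m≡m%n+[m/n]*n e n ⟨
      e                    ≤⟨ e≤e′ ⟩
      e′                   ≡⟨ m≡m%n+[m/n]*n e′ n ⟩
      e′ % n + e′ / n * n  ≡⟨ cong (λ k → e′ % n + k * n) same ⟨
      e′ % n + e / n * n   ∎))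
    where open ℕ.≤-Reasoning

  mod-wrap : ∀ {e e′} → e′ < e + n → e′ / n ≡ suc (e / n) → e′ mod n Fin.< e mod n
  mod-wrap {e} {e′} e′<e+n next = subst₂ _<_ (sym (toℕ-mod e′)) (sym (toℕ-mod e))
    (+-cancelʳ-< (suc (e / n) * n) (e′ % n) (e % n) (begin-strict
      e′ % n + suc (e / n) * n  ≡⟨ cong (λ k → e′ % n + k * n) next ⟨
      e′ % n + e′ / n * n       ≡⟨ m≡m%n+[m/n]*n e′ n ⟨
      e′                        <⟨ e′<e+n ⟩
      e + n                     ≡⟨ cong (_+ n) (m≡m%n+[m/n]*n e n) ⟩
      e % n + e / n * n + n     ≡⟨ +-assoc (e % n) _ n ⟩
      e % n + (e / n * n + n)   ≡⟨ cong (e % n +_) (+-comm (e / n * n) n) ⟩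
      e % n + suc (e / n) * n   ∎))
    where open ℕ.≤-Reasoning

module _ {n : ℕ} {t : Fin n → Bool} where

  mon-between : Mon t → ∀ {p q r} → p Fin.≤ q → q Fin.≤ r → t p ≡ t r → t q ≡ t p
  mon-between (inj₁ up)   {p} {q} {r} p≤q q≤r tp≡tr =
    Bool.≤-antisym (subst (t q Bool.≤_) (sym tp≡tr) (up q r q≤r)) (up p q p≤q)
  mon-between (inj₂ down) {p} {q} {r} p≤q q≤r tp≡tr =
    Bool.≤-antisym (down p q p≤q) (subst (Bool._≤ t q) (sym tp≡tr) (down q r q≤r))

  mon-beyond : Mon t → ∀ {p q r} → p Fin.≤ q → q Fin.≤ r → t p ≢ t q → t r ≡ t q
  mon-beyond mon {p} {q} {r} p≤q q≤r tp≢tq =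
    trans (¬-not tr≢tp) (sym (¬-not (tp≢tq ∘ sym)))
    where
      tr≢tp : t r ≢ t p
      tr≢tp tr≡tp = tp≢tq (sym (mon-between mon p≤q q≤r (sym tr≡tp)))

  mon-before : Mon t → ∀ {p q r} → p Fin.≤ q → q Fin.≤ r → t q ≢ t r → t p ≡ t q
  mon-before mon {p} {q} {r} p≤q q≤r tq≢tr =
    trans (¬-not tp≢tr) (sym (¬-not tq≢tr))
    where
      tp≢tr : t p ≢ t r
      tp≢tr tp≡tr = tq≢tr (trans (mon-between mon p≤q q≤r tp≡tr) tp≡tr)

WindowConvex : ℕ → (ℕ → Bool) → Set
WindowConvex n T = ∀ {e₁ e₂ e₃} → e₁ ≤ e₂ → e₂ ≤ e₃ → e₃ < e₁ + n → T e₁ ≡ T e₃ → T e₂ ≡ T e₁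

module _ {n : ℕ} .{{_ : NonZero n}} where

  -- Opaque, so that t and t′ are inferred from goals of the form ext t e ≡ ext t′ e.
  opaque
    ext : (Fin n → Bool) → ℕ → Bool
    ext t e = flipped (e / n) (t (e mod n))

  opaque
    unfolding ext

    ext-cong : ∀ {t t′ e} → t (e mod n) ≡ t′ (e mod n) → ext t e ≡ ext t′ e
    ext-cong {e = e} = cong (flipped (e / n))

    ext-cancel : ∀ {t t′ e} → ext t e ≡ ext t′ e → t (e mod n) ≡ t′ (e mod n)
    ext-cancel {e = e} = flipped-injective (e / n)

    ext-< : ∀ {t e} → e < n → ext t e ≡ t (e mod n)
    ext-< {t} {e} e<n = cong (λ k → flipped k (t (e mod n))) (m<n⇒m/n≡0 e<n)

    ext-+n : ∀ {t} e → ext t (e + n) ≡ not (ext t e)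
    ext-+n {t} e = cong₂ flipped ([e+n]/n≡1+e/n e) (cong t (mod-periodic e))

    private
      same-block : ∀ {t e e′} → e / n ≡ e′ / n → t (e mod n) ≡ t (e′ mod n) → ext t e ≡ ext t e′
      same-block {t} {e} {e′} k≡k′ tc≡tc′ = cong₂ flipped k≡k′ tc≡tc′

      same-block⁻¹ : ∀ {t e e′} → e / n ≡ e′ / n → ext t e ≡ ext t e′ → t (e mod n) ≡ t (e′ mod n)
      same-block⁻¹ {t} {e} {e′} k≡k′ eq =
        flipped-injective (e / n) (trans eq (cong (λ k → flipped k (t (e′ mod n))) (sym k≡k′)))

      next-block⁻¹ : ∀ {t e e′} → e′ / n ≡ suc (e / n) → ext t e ≡ ext t e′ → t (e mod n) ≢ t (e′ mod n)
      next-block⁻¹ {t} {e} {e′} next eq tc≡tc′ =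
        not-¬ refl (trans (cong (flipped (e / n)) (sym tc≡tc′))
                   (trans eq (cong (λ k → flipped k (t (e′ mod n))) next)))

    ext-convex : ∀ {t} → Mon t → WindowConvex n (ext t)
    ext-convex {t} mon {e₁} {e₂} {e₃} e₁≤e₂ e₂≤e₃ e₃<e₁+n ends
      with quotient-step e₁≤e₂ (≤-<-trans e₂≤e₃ e₃<e₁+n) | quotient-step (≤-trans e₁≤e₂ e₂≤e₃) e₃<e₁+n
    ... | inj₁ k₂≡k₁ | inj₁ k₃≡k₁ =
      sym (same-block {t = t} (sym k₂≡k₁) (sym (mon-between mon
        (mod-mono e₁≤e₂ (sym k₂≡k₁)) (mod-mono e₂≤e₃ (trans k₂≡k₁ (sym k₃≡k₁)))
        (same-block⁻¹ {t = t} (sym k₃≡k₁) ends))))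
    ... | inj₁ k₂≡k₁ | inj₂ k₃≡1+k₁ =
      sym (same-block {t = t} (sym k₂≡k₁) (sym (mon-beyond mon
        (<⇒≤ (mod-wrap e₃<e₁+n k₃≡1+k₁)) (mod-mono e₁≤e₂ (sym k₂≡k₁))
        (next-block⁻¹ {t = t} k₃≡1+k₁ ends ∘ sym))))
    ... | inj₂ k₂≡1+k₁ | inj₂ k₃≡1+k₁ =
      trans (same-block {t = t} (trans k₂≡1+k₁ (sym k₃≡1+k₁)) (mon-before mon
        (mod-mono e₂≤e₃ (trans k₂≡1+k₁ (sym k₃≡1+k₁))) (<⇒≤ (mod-wrap e₃<e₁+n k₃≡1+k₁))
        (next-block⁻¹ {t = t} k₃≡1+k₁ ends ∘ sym))) (sym ends)
    ... | inj₂ k₂≡1+k₁ | inj₁ k₃≡k₁ =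
      contradiction (subst₂ _≤_ k₂≡1+k₁ k₃≡k₁ (/-monoˡ-≤ n e₂≤e₃)) ℕ.1+n≰n

module _ {n α α′ ι β′ β : ℕ} (α≤α′ : α ≤ α′) (α′≤ι : α′ ≤ ι) (ι≤β′ : ι ≤ β′) (β′≤β : β′ ≤ β)
         (β<α+n : β < α + n) {T U R W : ℕ → Bool} where

  glued-flips : WindowConvex n T → WindowConvex n U → WindowConvex n R → WindowConvex n W →
                T α ≡ T β → U α ≡ T α → U ι ≡ T ι → R β ≡ T β → R ι ≡ T ι →
                W α ≡ R α → W β ≡ U β → U α′ ≢ U β → R α ≢ R β′ →
                W α′ ≡ W β × W ι ≡ not (T ι)
  glued-flips T-cvx U-cvx R-cvx W-cvx Tα≡Tβ Uα Uι Rβ Rι Wα Wβ U-breaks R-breaks =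
    trans (W-const α≤α′ (≤-trans α′≤ι ι≤β)) Wα≡Wβ ,
    trans (W-const α≤ι ι≤β) (trans (trans Wα Rα) (cong not (sym Tι)))
    where
      α≤ι : α ≤ ι
      α≤ι = ≤-trans α≤α′ α′≤ι
      ι≤β : ι ≤ β
      ι≤β = ≤-trans ι≤β′ β′≤β
      ι<α+n : ι < α + n
      ι<α+n = ≤-<-trans ι≤β β<α+n
      β<ι+n : β < ι + n
      β<ι+n = <-≤-trans β<α+n (ℕ.+-monoˡ-≤ n α≤ι)
      Tι : T ι ≡ T α
      Tι = T-cvx α≤ι ι≤β β<α+n Tα≡Tβ
      Uα′ : U α′ ≡ U α
      Uα′ = U-cvx α≤α′ α′≤ι ι<α+n (trans Uα (sym (trans Uι Tι)))
      Uβ : U β ≡ not (T α)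
      Uβ = ¬-not λ Uβ≡Tα → U-breaks (trans Uα′ (trans Uα (sym Uβ≡Tα)))
      Rβ′ : R β′ ≡ R ι
      Rβ′ = R-cvx ι≤β′ β′≤β β<ι+n (trans Rι (trans Tι (trans Tα≡Tβ (sym Rβ))))
      Rα : R α ≡ not (T α)
      Rα = ¬-not λ Rα≡Tα → R-breaks (trans Rα≡Tα (sym (trans Rβ′ (trans Rι Tι))))
      Wα≡Wβ : W α ≡ W β
      Wα≡Wβ = trans (trans Wα Rα) (sym (trans Wβ Uβ))
      W-const : ∀ {e} → α ≤ e → e ≤ β → W e ≡ W α
      W-const α≤e e≤β = W-cvx α≤e e≤β β<α+n Wα≡Wβ

-- ⇑⟦lo, hi⟧, the positions being read linearly in ℕ.
AllWindows : ∀ {m} (n : ℕ) .{{_ : NonZero n}} → (Fin n → Subset m) → ℕ → ℕ → Fin m → Set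
AllWindows n w lo hi k = ∀ e → lo ≤ e → e ≤ hi → k ∈ w (e mod n)

module _ {m n : ℕ} .{{_ : NonZero n}} {w : Fin n → Subset m} {k : Fin m} where

  allWindows-point : ∀ {e} → k ∈ w (e mod n) → AllWindows n w e e k
  allWindows-point k∈w e′ e≤e′ e′≤e rewrite ℕ.≤-antisym e′≤e e≤e′ = k∈w

  allWindows-extendˡ : ∀ {lo hi} → k ∈ w (lo mod n) → AllWindows n w (suc lo) hi k → AllWindows n w lo hi k
  allWindows-extendˡ k∈w all e lo≤e e≤hi with m≤n⇒m<n∨m≡n lo≤e
  ... | inj₁ lo<e = all e lo<e e≤hi
  ... | inj₂ refl = k∈w

  allWindows-extendʳ : ∀ {lo hi} → k ∈ w (suc hi mod n) → AllWindows n w lo hi k → AllWindows n w lo (suc hi) k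
  allWindows-extendʳ k∈w all e lo≤e e≤1+hi with m≤n⇒m<n∨m≡n e≤1+hi
  ... | inj₁ (s≤s e≤hi) = all e lo≤e e≤hi
  ... | inj₂ refl       = k∈w

hybrid : ∀ {m b} → (Fin m → Bool) → Input m b → Input m b → Input m b
hybrid P Z x k = if P k then Z k else x k

hybrid-agree : ∀ {m b} {Z x : Input m b} (P Q : Fin m → Bool) {k} → x k ≡ Z k → hybrid P Z x k ≡ hybrid Q Z x k
hybrid-agree P Q {k} x≡Z with P k | Q k
... | true  | true  = refl
... | true  | false = sym x≡Z
... | false | true  = x≡Z
... | false | false = refl

module Forcing {m b n : ℕ} .{{_ : NonZero n}} (f : Input m b → (Fin n → Bool)) (f-mon : ∀ x → Mon (f x))
               (w : Fin n → Subset m) (w-det : ∀ i → Determines f i (w i)) (J : ℕ) where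

  j : Fin n
  j = J mod n

  Forces : ℕ → ℕ → Set
  Forces lo hi = ∀ Z x → (∀ k → AllWindows n w lo J k ⊎ AllWindows n w J hi k → x k ≡ Z k)
               → ext (f Z) lo ≡ ext (f Z) hi → f x j ≡ f Z j

  hybrids-agree-at : ∀ e {Z x} (P Q : Fin m → Bool) → (∀ k → lookup (w (e mod n)) k ≡ true → P k ≡ Q k)
                   → ext (f (hybrid P Z x)) e ≡ ext (f (hybrid Q Z x)) e
  hybrids-agree-at e {Z} {x} P Q P≡Q = ext-cong (w-det (e mod n) _ _ λ k k∈w →
    cong (λ β → if β then Z k else x k) (P≡Q k ([]=⇒lookup k∈w)))

  module Step {lo hi′ : ℕ} (1+lo≤J : suc lo ≤ J) (J≤hi′ : J ≤ hi′) (1+hi′<lo+n : suc hi′ < lo + n)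
              (IHˡ : Forces (suc lo) (suc hi′)) (IHʳ : Forces lo hi′) where

    A B : Fin m → Bool
    A = lookup (w (lo mod n))
    B = lookup (w (suc hi′ mod n))

    module _ {Z x : Input m b} (agree : ∀ k → AllWindows n w lo J k ⊎ AllWindows n w J (suc hi′) k → x k ≡ Z k) where

      off-A : ∀ P Q → (∀ k → A k ≡ false → P k ≡ Q k)
            → ∀ k → AllWindows n w (suc lo) J k ⊎ AllWindows n w J (suc hi′) k → hybrid Q Z x k ≡ hybrid P Z x k
      off-A P Q P≡Q k (inj₂ right) = hybrid-agree {Z = Z} {x = x} Q P (agree k (inj₂ right))
      off-A P Q P≡Q k (inj₁ left) with A k in Ak
      ... | true  = hybrid-agree {Z = Z} {x = x} Q P (agree k (inj₁ (allWindows-extendˡ {w = w} (lookup⇒[]= k _ Ak) left)))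
      ... | false = cong (λ β → if β then Z k else x k) (sym (P≡Q k Ak))

      off-B : ∀ P Q → (∀ k → B k ≡ false → P k ≡ Q k)
            → ∀ k → AllWindows n w lo J k ⊎ AllWindows n w J hi′ k → hybrid Q Z x k ≡ hybrid P Z x k
      off-B P Q P≡Q k (inj₁ left) = hybrid-agree {Z = Z} {x = x} Q P (agree k (inj₁ left))
      off-B P Q P≡Q k (inj₂ right) with B k in Bk
      ... | true  = hybrid-agree {Z = Z} {x = x} Q P (agree k (inj₂ (allWindows-extendʳ {w = w} (lookup⇒[]= k _ Bk) right)))
      ... | false = cong (λ β → if β then Z k else x k) (sym (P≡Q k Bk))

    module Refutation {Z x : Input m b}
                      (agree : ∀ k → AllWindows n w lo J k ⊎ AllWindows n w J (suc hi′) k → x k ≡ Z k)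
                      (ends : ext (f Z) lo ≡ ext (f Z) (suc hi′)) (x≢Z : f x j ≢ f Z j) where

      hi : ℕ
      hi = suc hi′
      lo≤1+lo : lo ≤ suc lo
      lo≤1+lo = ℕ.n≤1+n lo
      hi′≤hi : hi′ ≤ hi
      hi′≤hi = ℕ.n≤1+n hi′
      lo≤J : lo ≤ J
      lo≤J = ≤-trans lo≤1+lo 1+lo≤J
      J≤hi : J ≤ hi
      J≤hi = ≤-trans J≤hi′ hi′≤hi

      hyb : (Fin m → Bool) → Input m b
      hyb P = hybrid P Z x

      A∨B A∧B : Fin m → Bool
      A∨B k = A k ∨ B k
      A∧B k = A k ∧ B k

      T U R W : ℕ → Bool
      T = ext (f (hyb A∨B))
      U = ext (f (hyb A))
      R = ext (f (hyb B))
      W = ext (f (hyb A∧B))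

      convex : ∀ z → WindowConvex n (ext (f z))
      convex z = ext-convex (f-mon z)

      Tlo : T lo ≡ ext (f Z) lo
      Tlo = hybrids-agree-at lo A∨B (λ _ → true) λ k Ak → cong (_∨ B k) Ak

      Thi : T hi ≡ ext (f Z) hi
      Thi = hybrids-agree-at hi A∨B (λ _ → true) λ k Bk → trans (cong (A k ∨_) Bk) (Bool.∨-zeroʳ (A k))

      T-ends : T lo ≡ T hi
      T-ends = trans Tlo (trans ends (sym Thi))

      Z∪-j : f (hyb A∨B) j ≡ f Z j
      Z∪-j = ext-cancel (trans (convex _ lo≤J J≤hi 1+hi′<lo+n T-ends)
                       (trans Tlo (sym (convex Z lo≤J J≤hi 1+hi′<lo+n ends))))

      Zᴬ-j : f (hyb A) j ≡ f (hyb A∨B) j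
      Zᴬ-j = IHʳ (hyb A∨B) (hyb A)
        (off-B agree A∨B A λ k Bk → trans (cong (A k ∨_) Bk) (Bool.∨-identityʳ (A k)))
        (sym (convex _ (≤-trans lo≤J J≤hi′) hi′≤hi 1+hi′<lo+n T-ends))

      Zᴮ-j : f (hyb B) j ≡ f (hyb A∨B) j
      Zᴮ-j = IHˡ (hyb A∨B) (hyb B)
        (off-A agree A∨B B λ k Ak → cong (_∨ B k) Ak)
        (trans (convex _ lo≤1+lo (≤-trans 1+lo≤J J≤hi) 1+hi′<lo+n T-ends) T-ends)

      U-breaks : U (suc lo) ≢ U hi
      U-breaks U-ends = x≢Z (trans (IHˡ (hyb A) x (off-A agree A (λ _ → false) λ _ Ak → Ak) U-ends)
                                   (trans Zᴬ-j Z∪-j))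

      R-breaks : R lo ≢ R hi′
      R-breaks R-ends = x≢Z (trans (IHʳ (hyb B) x (off-B agree B (λ _ → false) λ _ Bk → Bk) R-ends)
                                   (trans Zᴮ-j Z∪-j))

      W-flips : W (suc lo) ≡ W hi × W J ≡ not (T J)
      W-flips = glued-flips lo≤1+lo 1+lo≤J J≤hi′ hi′≤hi 1+hi′<lo+n
        (convex _) (convex _) (convex _) (convex _) T-ends
        (hybrids-agree-at lo A A∨B λ k Ak → trans Ak (sym (cong (_∨ B k) Ak)))
        (ext-cong Zᴬ-j)
        (hybrids-agree-at hi B A∨B λ k Bk → trans Bk (sym (trans (cong (A k ∨_) Bk) (Bool.∨-zeroʳ (A k)))))
        (ext-cong Zᴮ-j)
        (hybrids-agree-at lo A∧B B λ k Ak → cong (_∧ B k) Ak)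
        (hybrids-agree-at hi A∧B A λ k Bk → trans (cong (A k ∧_) Bk) (Bool.∧-identityʳ (A k)))
        U-breaks R-breaks

      WJ≡TJ : W J ≡ T J
      WJ≡TJ = ext-cong (trans (sym (IHˡ (hyb A∧B) (hyb A)
                (off-A agree A∧B A λ k Ak → trans (cong (_∧ B k) Ak) (sym Ak)) (proj₁ W-flips))) Zᴬ-j)

      absurd : ⊥
      absurd = not-¬ WJ≡TJ (proj₂ W-flips)

    forces : Forces lo (suc hi′)
    forces Z x agree ends with f x j Bool.≟ f Z j
    ... | yes x≡Z = x≡Z
    ... | no  x≢Z = ⊥-elim (Refutation.absurd agree ends x≢Z)

  forcing′ : ∀ p q {lo} → p + lo ≡ J → q + J < lo + n → Forces lo (q + J)
  forcing′ zero    q       refl _ Z x agree _ = w-det j x Z λ k k∈wj → agree k (inj₁ (allWindows-point {w = w} k∈wj))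
  forcing′ (suc p) zero    _    _ Z x agree _ = w-det j x Z λ k k∈wj → agree k (inj₂ (allWindows-point {w = w} k∈wj))
  forcing′ (suc p) (suc q) {lo} J≡ width = Step.forces
    (subst (suc lo ≤_) J≡ (s≤s (m≤n+m lo p))) (m≤n+m J q) width
    (forcing′ p (suc q) (trans (ℕ.+-suc p lo) J≡) (≤-trans width (ℕ.n≤1+n _)))
    (forcing′ (suc p) q J≡ (≤-trans (ℕ.n≤1+n _) width))

  forcing : ∀ {lo hi} → lo ≤ J → J ≤ hi → hi < lo + n → Forces lo hi
  forcing {lo} {hi} lo≤J J≤hi hi<lo+n = subst (Forces lo) (m∸n+n≡m J≤hi)
    (forcing′ (J ∸ lo) (hi ∸ J) (m∸n+n≡m lo≤J) (subst (_< lo + n) (sym (m∸n+n≡m J≤hi)) hi<lo+n))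

module _ {n : ℕ} .{{_ : NonZero n}} where

  offset-cong : ∀ {a a′ c c′} → a % n ≡ a′ % n → c % n ≡ c′ % n → offset n a c ≡ offset n a′ c′
  offset-cong = cong₂ λ r s → ((n + s) ∸ r) % n

  offset-≡-% : ∀ {a e} → a ≤ e → offset n a e ≡ (e ∸ a) % n
  offset-≡-% {a} {e} a≤e = begin
    X % n                      ≡⟨ [m+kn]%n≡m%n X (e / n) n ⟨
    (X + e / n * n) % n        ≡⟨ cong (_% n) (ℕ.+-cancelʳ-≡ (a % n) _ _ shifted) ⟩
    (d + suc (a / n) * n) % n  ≡⟨ [m+kn]%n≡m%n d (suc (a / n)) n ⟩
    d % n                      ∎
    where
      open ≡-Reasoning
      X d : ℕ
      X = n + e % n ∸ a % n
      d = e ∸ a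
      reorder₁ : ∀ x y z → x + y + z ≡ x + z + y
      reorder₁ = solve-∀
      reorder₂ : ∀ n d r q → n + (d + (r + q)) ≡ d + (n + q) + r
      reorder₂ = solve-∀
      shifted : X + e / n * n + a % n ≡ d + suc (a / n) * n + a % n
      shifted = begin
        X + e / n * n + a % n          ≡⟨ reorder₁ X _ _ ⟩
        X + a % n + e / n * n          ≡⟨ cong (_+ e / n * n) (m∸n+n≡m (≤-trans (m%n≤n a n) (m≤m+n n _))) ⟩
        n + e % n + e / n * n          ≡⟨ +-assoc n _ _ ⟩
        n + (e % n + e / n * n)        ≡⟨ cong (n +_) (m≡m%n+[m/n]*n e n) ⟨
        n + e                          ≡⟨ cong (n +_) (m∸n+n≡m a≤e) ⟨
        n + (d + a)                    ≡⟨ cong (λ a′ → n + (d + a′)) (m≡m%n+[m/n]*n a n) ⟩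
        n + (d + (a % n + a / n * n))  ≡⟨ reorder₂ n d _ _ ⟩
        d + suc (a / n) * n + a % n    ∎

  offset-linear : ∀ {a e} → a ≤ e → e < a + n → offset n a e ≡ e ∸ a
  offset-linear {a} {e} a≤e e<a+n = trans (offset-≡-% a≤e) (m<n⇒m%n≡m (+-cancelʳ-< a (e ∸ a) n
    (subst₂ _<_ (sym (m∸n+n≡m a≤e)) (+-comm a n) e<a+n)))

  +-offset-% : ∀ a c → (a + offset n a c) % n ≡ c % n
  +-offset-% a c = begin
    (a + X % n) % n            ≡⟨ %-distribˡ-+ a (X % n) n ⟩
    (a % n + X % n % n) % n    ≡⟨ cong (λ s → (a % n + s) % n) (m%n%n≡m%n X n) ⟩
    (a % n + X % n) % n        ≡⟨ cong (λ r → (r + X % n) % n) (m%n%n≡m%n a n) ⟨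
    (a % n % n + X % n) % n    ≡⟨ %-distribˡ-+ (a % n) X n ⟨
    (a % n + X) % n            ≡⟨ cong (_% n) (ℕ.m+[n∸m]≡n (≤-trans (m%n≤n a n) (m≤m+n n _))) ⟩
    (n + c % n) % n            ≡⟨ cong (_% n) (+-comm n (c % n)) ⟩
    (c % n + n) % n            ≡⟨ [m+n]%n≡m%n (c % n) n ⟩
    c % n % n                  ≡⟨ m%n%n≡m%n c n ⟩
    c % n                      ∎
    where
      open ≡-Reasoning
      X : ℕ
      X = n + c % n ∸ a % n

module _ {m n : ℕ} .{{_ : NonZero n}} (w : Fin n → Subset m) where

  allWindows⇒inUp : ∀ {a b k} → a ≤ b → b < a + n → AllWindows n w a b k → InUp n w a b k
  allWindows⇒inUp {a} {b} {k} a≤b b<a+n all c c∈[a,b] = subst (λ c′ → k ∈ w c′) e-mod (all e (m≤m+n a _) e≤b)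
    where
      e : ℕ
      e = a + offset n a (toℕ c)
      e≤b : e ≤ b
      e≤b = ≤-trans (ℕ.+-monoʳ-≤ a c∈[a,b])
                    (ℕ.≤-reflexive (trans (cong (a +_) (offset-linear a≤b b<a+n)) (ℕ.m+[n∸m]≡n a≤b)))
      e-mod : e mod n ≡ c
      e-mod = toℕ-injective (trans (toℕ-mod e) (trans (+-offset-% a (toℕ c)) (m<n⇒m%n≡m (toℕ<n c))))

  inUp-cong : ∀ {a a′ b b′ k} → a % n ≡ a′ % n → b % n ≡ b′ % n → InUp n w a b k → InUp n w a′ b′ k
  inUp-cong a≡a′ b≡b′ up c c∈[a′,b′] =
    up c (subst₂ _≤_ (offset-cong (sym a≡a′) refl) (offset-cong (sym a≡a′) (sym b≡b′)) c∈[a′,b′])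

  inUp? : ∀ a b k → Dec (InUp n w a b k)
  inUp? a b k = all? λ c → (offset n a (toℕ c) ℕ.≤? offset n a b) →-dec (k ∈? w c)

module _ {m b : ℕ} {P : Fin m → Set} (P? : ∀ k → Dec (P k)) (x : Input m b) where

  restrict : PartialInput m b
  restrict k = if does (P? k) then just (x k) else nothing

  restrict-dom : ∀ k → InDom restrict k ⇔ P k
  restrict-dom k with P? k
  ... | yes Pk = mk⇔ (λ _ → Pk) (λ _ → x k , refl)
  ... | no ¬Pk = mk⇔ (λ { (_ , ()) }) (λ Pk → contradiction Pk ¬Pk)

  restrict-agrees : ∀ {y} → Extends y restrict → ∀ k → P k → y k ≡ x k
  restrict-agrees y-ext k Pk = y-ext k (x k) (cong (λ β → if β then just (x k) else nothing) (dec-true (P? k) Pk))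

module _ {n : ℕ} (i : Fin n) where

  ≤?-antitone : NonIncr (λ (c : Fin n) → does (c Fin.≤? i))
  ≤?-antitone p q p≤q = does-antitone (q Fin.≤? i) (p Fin.≤? i)
    where
      does-antitone : (q≤?i : Dec (q Fin.≤ i)) (p≤?i : Dec (p Fin.≤ i)) → does q≤?i Bool.≤ does p≤?i
      does-antitone (yes _)   (yes _)   = Bool.b≤b
      does-antitone (yes q≤i) (no  p≰i) = contradiction (≤-trans p≤q q≤i) p≰i
      does-antitone (no  _)   (yes _)   = Bool.f≤t
      does-antitone (no  _)   (no  _)   = Bool.b≤b

  stepAt : Bool → Fin n → Bool
  stepAt u c = u xor does (c Fin.≤? i)

  stepAt-mon : ∀ u → Mon (stepAt u)
  stepAt-mon false = inj₂ ≤?-antitone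
  stepAt-mon true  = inj₁ λ p q p≤q → not-antitone (≤?-antitone p q p≤q)

  stepAt-≤ : ∀ {u c} → c Fin.≤ i → stepAt u c ≡ not u
  stepAt-≤ {u} {c} c≤i = trans (cong (u xor_) (dec-true (c Fin.≤? i) c≤i)) (Bool.xor-comm u true)

  stepAt-> : ∀ {u c} → i Fin.< c → stepAt u c ≡ u
  stepAt-> {u} {c} i<c = trans (cong (u xor_) (dec-false (c Fin.≤? i) (ℕ.<⇒≱ i<c))) (Bool.xor-identityʳ u)

module _ {n : ℕ} .{{_ : NonZero n}} (i : Fin n) where

  stepAt-cut : ∀ u → ext (stepAt i u) (suc (toℕ i)) ≡ ext (stepAt i u) (toℕ i + n)
  stepAt-cut u = trans lo-value (sym hi-value)
    where
      below : ∀ {e} → e ≤ toℕ i → e < n → ext (stepAt i u) e ≡ not u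
      below e≤i e<n = trans (ext-< e<n) (stepAt-≤ i (subst (_≤ toℕ i) (sym (toℕ-mod-< e<n)) e≤i))
      hi-value : ext (stepAt i u) (toℕ i + n) ≡ u
      hi-value = trans (ext-+n (toℕ i)) (trans (cong not (below ≤-refl (toℕ<n i))) (Bool.not-involutive u))
      lo-value : ext (stepAt i u) (suc (toℕ i)) ≡ u
      lo-value with m≤n⇒m<n∨m≡n (toℕ<n i)
      ... | inj₁ 1+i<n = trans (ext-< 1+i<n) (stepAt-> i (subst (toℕ i <_) (sym (toℕ-mod-< 1+i<n)) ≤-refl))
      ... | inj₂ 1+i≡n = subst (λ e → ext (stepAt i u) e ≡ u) (sym 1+i≡n)
        (trans (ext-+n 0) (trans (cong not (below z≤n (ℕ.>-nonZero⁻¹ n))) (Bool.not-involutive u)))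

  cyclic-representative : (j : Fin n) → ∃ λ J → suc (toℕ i) ≤ J × J ≤ toℕ i + n × J % n ≡ toℕ j
  cyclic-representative j with j Fin.≤? i
  ... | yes j≤i = toℕ j + n , ≤-trans (toℕ<n i) (m≤n+m n (toℕ j)) , ℕ.+-monoˡ-≤ n j≤i ,
                  trans ([m+n]%n≡m%n (toℕ j) n) (m<n⇒m%n≡m (toℕ<n j))
  ... | no  j≰i = toℕ j , ℕ.≰⇒> j≰i , ≤-trans (<⇒≤ (toℕ<n j)) (m≤n+m n (toℕ i)) , m<n⇒m%n≡m (toℕ<n j)

module _ {m b n : ℕ} .{{_ : NonZero n}} (f : Input m b → (Fin n → Bool)) (f-mon : ∀ x → Mon (f x))
         (w : Fin n → Subset m) (w-det : ∀ i → Determines f i (w i)) (i j : Fin n) where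

  interval-forcing : ∀ Z → ext (f Z) (suc (toℕ i)) ≡ ext (f Z) (toℕ i + n)
                   → ∀ x → (∀ k → InUp n w (suc (toℕ i)) (toℕ j) k ⊎ InUp n w (toℕ j) (toℕ i) k → x k ≡ Z k)
                   → f x j ≡ f Z j
  interval-forcing Z cut x agree with cyclic-representative i j
  ... | J , 1+i≤J , J≤i+n , J%n≡j =
    subst (λ c → f x c ≡ f Z c) J-mod (forcing 1+i≤J J≤i+n ≤-refl Z x (λ k → agree k ∘ Sum.map left right) cut)
    where
      open Forcing f f-mon w w-det J using (forcing)
      J≡j : J % n ≡ toℕ j % n
      J≡j = trans J%n≡j (sym (m<n⇒m%n≡m (toℕ<n j)))
      J-mod : J mod n ≡ j
      J-mod = toℕ-injective (trans (toℕ-mod J) J%n≡j)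
      left : ∀ {k} → AllWindows n w (suc (toℕ i)) J k → InUp n w (suc (toℕ i)) (toℕ j) k
      left = inUp-cong w refl J≡j ∘ allWindows⇒inUp w 1+i≤J (s≤s J≤i+n)
      right : ∀ {k} → AllWindows n w J (toℕ i + n) k → InUp n w (toℕ j) (toℕ i) k
      right = inUp-cong w J≡j ([m+n]%n≡m%n (toℕ i) n) ∘ allWindows⇒inUp w J≤i+n (ℕ.+-monoˡ-< n 1+i≤J)

theorem5p2 : (n : ℕ) → .{{_ : NonZero n}} → (m b : ℕ)
    → (f : Input m b → (Fin n → Bool))
    → ImageIsMon f
    → (w : Fin n → Subset m) → (∀ i → IsWindow f i (w i))
    → (i j : Fin n) (v : Bool)
    → ∃ λ (α : PartialInput m b)
        → (∀ k → InDom α k ⇔ (InUp n w (suc (toℕ i)) (toℕ j) k ⊎ InUp n w (toℕ j) (toℕ i) k))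
        × (∀ x → Extends x α → f x j ≡ v)
theorem5p2 n m b f (f-mon , f-onto) w windows i j v =
  restrict dom? x₀ , restrict-dom dom? x₀ , λ x x-ext →
    trans (interval-forcing f f-mon w (proj₁ ∘ windows) i j x₀ cut x (restrict-agrees dom? x₀ x-ext))
          (trans (fx₀≡y j) y-at-j)
  where
    dom? : ∀ k → Dec (InUp n w (suc (toℕ i)) (toℕ j) k ⊎ InUp n w (toℕ j) (toℕ i) k)
    dom? k = inUp? w _ _ k ⊎-dec inUp? w _ _ k
    d u : Bool
    d = does (j Fin.≤? i)
    u = v xor d
    x₀ : Input m b
    x₀ = proj₁ (f-onto (stepAt i u) (stepAt-mon i u))
    fx₀≡y : ∀ c → f x₀ c ≡ stepAt i u c
    fx₀≡y = proj₂ (f-onto (stepAt i u) (stepAt-mon i u))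
    cut : ext (f x₀) (suc (toℕ i)) ≡ ext (f x₀) (toℕ i + n)
    cut = trans (ext-cong (fx₀≡y _)) (trans (stepAt-cut i u) (sym (ext-cong (fx₀≡y _))))
    y-at-j : stepAt i u j ≡ v
    y-at-j = trans (Bool.xor-assoc v d d) (trans (cong (v xor_) (Bool.xor-same d)) (Bool.xor-identityʳ v))
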